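{- Let $n = 2k$ with $k \ge 2$, and let $\mu(k)$ be the largest odd integer not exceeding $k$. Let $C = C(n,\{1,3,5,\ldots,\mu(k)\})$. Place the vertices of $C$ on a circle in a YSL-order and draw every edge as a straight chord. Then there is a coloring of the edges of $C$ with $\Delta(C)$ colors such that: (i) two edges of the same color neither share an endpoint nor cross; (ii) within each color class, all edges have the same jump-length. That is, for some single $s$, every edge $ij$ in the class satisfies $j \equiv i \pm s \pmod n$.
   Context: Circulants. For $n \ge 3$ and $S \subseteq \{1,2,\ldots,\lfloor n/2\rfloor\}$, the circulant $C(n,S)$ is the graph with vertex set $\{1,\ldots,n\}$. Its edge set is $\{ij : j \equiv i+s \pmod n \text{ for some } s \in S\}$. The elements of $S$ are called jump-lengths. $\Delta(G)$ denotes the maximum degree of $G$. YSL-order. Let $n = 2k$. Label the positions on a circle, in clockwise order, as $p_1, p_2, \ldots, p_{2k}$. A YSL-order places the odd vertices at the odd positions in their natural clockwise order, namely vertex $2i-1$ at position $p_{2i-1}$. It places the even vertices at the even positions so that, read clockwise, they appear in counterclockwise (decreasing cyclic) order. In other words, there is a fixed integer $m$ such that position $p_{2i}$ carries the even vertex congruent to $2m-2i \pmod{2k}$, for $i = 1,\ldots,k$. The value of $m$, that is, where vertex $2$ is placed, is arbitrary. For example, one YSL-order reads clockwise $\ldots, 2k-3, 4, 2k-1, 2, 1, 2k, 3, 2k-2, 5, \ldots$. Crossing and dispersability. Two chords cross if their four endpoints are distinct and interleave around the circle. A graph drawn with vertices on a circle and edges as chords is dispersable with respect to that vertex order if its edges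 can be colored with $\Delta(G)$ colors so that two edges of the same color neither share an endpoint nor cross. The color classes are called pages. -}

module Defs where

open import Data.Nat using (ℕ; zero; suc; _+_; _*_; _∸_; _<_; _≤ᵇ_; _≡ᵇ_; _⊔_)
open import Data.Nat.DivMod using (_%_)
open import Data.Bool using (Bool; true; false; _∧_; _∨_; T; if_then_else_)
open import Data.Fin using (Fin; toℕ)
open import Data.List using (List; map; foldr; upTo; allFin)
open import Data.Bool.ListAction using (any)
open import Data.Product using (Σ; _×_)
open import Data.Sum using (_⊎_)
open import Relation.Nullary using (¬_)
open import Relation.Binary.PropositionalEquality using (_≡_; _≢_)

-- reduction modulo n (with the harmless convention a mod 0 = a)
_mod′_ : ℕ → ℕ → ℕ
a mod′ zero = a
a mod′ suc n = a % suc n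

_≡_[mod_] : ℕ → ℕ → ℕ → Set
a ≡ b [mod n ] = a mod′ n ≡ b mod′ n

_≡ᵇ_[mod_] : ℕ → ℕ → ℕ → Bool
a ≡ᵇ b [mod n ] = (a mod′ n) ≡ᵇ (b mod′ n)

Odd : ℕ → Set
Odd a = a % 2 ≡ 1

Even : ℕ → Set
Even a = a % 2 ≡ 0

μ : ℕ → ℕ
μ k = if (k % 2 ≡ᵇ 1) then k else k ∸ 1

isJumpᵇ : ℕ → ℕ → Bool
isJumpᵇ k s = (s % 2 ≡ᵇ 1) ∧ ((1 ≤ᵇ s) ∧ (s ≤ᵇ μ k))

-- Vertices of C(2k, S) are Fin (2 * k); vertex v has label toℕ v + 1 ∈ {1,…,2k}.
label : ∀ {n} → Fin n → ℕ
label v = suc (toℕ v)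

edgeᵇ : (n : ℕ) → Fin n → Fin n → ℕ → Bool
edgeᵇ n i j s = label j ≡ᵇ (label i + s) [mod n ]

adjᵇ : (k : ℕ) → Fin (2 * k) → Fin (2 * k) → Bool
adjᵇ k i j = any (λ s → isJumpᵇ k s ∧ (edgeᵇ (2 * k) i j s ∨ edgeᵇ (2 * k) j i s)) (upTo (suc k))

Adj : (k : ℕ) → Fin (2 * k) → Fin (2 * k) → Set
Adj k i j = T (adjᵇ k i j)

countᵇ : ∀ {A : Set} → (A → Bool) → List A → ℕ
countᵇ p = foldr (λ x r → if p x then suc r else r) 0

degree : (k : ℕ) → Fin (2 * k) → ℕ
degree k i = countᵇ (adjᵇ k i) (allFin (2 * k))

Δ : ℕ → ℕ
Δ k = foldr _⊔_ 0 (map (degree k) (allFin (2 * k)))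

-- pos : vertex ↦ position; position p has label toℕ p + 1 (p_1,…,p_{2k} clockwise).
-- YSL-order: odd vertex 2i-1 sits at p_{2i-1}; the even position p_{2i} carries the even
-- vertex congruent to 2m - 2i (mod 2k), i.e. even vertex 2j sits at even p_{2i} with 2j + 2i ≡ 2m.
IsYSL : (k : ℕ) → (Fin (2 * k) → Fin (2 * k)) → Set
IsYSL k pos = Σ ℕ λ m → ∀ v →
  (Odd (label v) → label (pos v) ≡ label v) ×
  (Even (label v) → Even (label (pos v)) × ((label v + label (pos v)) ≡ (2 * m) [mod (2 * k) ]))

Between : ℕ → ℕ → ℕ → Set
Between x y z = (x < z × z < y) ⊎ (y < z × z < x)

-- chords ab and cd cross: four distinct endpoints whose positions interleave around the circle
Cross : ∀ {n} → (Fin n → Fin n) → Fin n → Fin n → Fin n → Fin n → Set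
Cross pos a b c d =
  (a ≢ b × a ≢ c × a ≢ d × b ≢ c × b ≢ d × c ≢ d) ×
  ((Between pa pb pc × ¬ Between pa pb pd) ⊎ (¬ Between pa pb pc × Between pa pb pd))
  where
    pa = toℕ (pos a)
    pb = toℕ (pos b)
    pc = toℕ (pos c)
    pd = toℕ (pos d)

-- All jump-lengths are odd and 2k is even, so every edge joins an odd and an even vertex,
-- and a YSL-order puts each vertex at a position of its own parity; hence the positions
-- p, q of an edge have odd sum p + q mod 2k.  Colour the edge by ⌊(p + q mod 2k) / 2⌋.
-- Each of these k classes consists of chords with one position sum, i.e. of parallel
-- chords, which neither share an endpoint nor cross.  The odd endpoint sits at its own
-- label and the even one at 2m minus its label, so the position sum r fixes
-- odd − even ≡ r + 2 − 2m, a single jump-length.  Finally k ≤ Δ since vertex 1 is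
-- adjacent to all k even vertices.
module Submission where

open import Defs
open import Data.Nat using (ℕ; zero; suc; _+_; _*_; _∸_; _<_; _≤_; z≤n; s≤s; _≤?_; ⌊_/2⌋; NonZero; >-nonZero⁻¹)
open import Data.Nat.Properties
open import Data.Nat.DivMod
open import Data.Nat.Tactic.RingSolver using (solve-∀)
open import Data.Nat.Divisibility using (_∣_; m∣m*n; n∣m⇒m%n≡0)
open import Algebra.Properties.CommutativeSemigroup +-commutativeSemigroup using (x∙yz≈y∙xz; xy∙z≈y∙xz; xy∙z≈xz∙y)
open import Data.Bool using (Bool; true; false; T; _∧_; _∨_)
open import Data.Bool.Properties using (T-∧; T-∨)
open import Data.Fin using (Fin; toℕ; fromℕ<; inject≤)
import Data.Fin as Fin
open import Data.Fin.Properties using (toℕ-injective; toℕ-fromℕ<; toℕ-inject≤; toℕ<n)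
open import Data.List using (tabulate; upTo)
open import Data.List.Relation.Unary.Any using (satisfied)
open import Data.List.Relation.Unary.Any.Properties using (any⁺; any⁻)
open import Data.List.Membership.Propositional using (lose)
open import Data.List.Membership.Propositional.Properties using (∈-upTo⁺)
open import Data.Product using (Σ; _×_; _,_; proj₁; proj₂)
open import Data.Sum using (_⊎_; inj₁; inj₂)
import Data.Sum as Sum
open import Function using (_∘_)
open import Function.Bundles using (Equivalence)
open import Function.Definitions using (Injective)
open import Relation.Nullary using (¬_; yes; no)
open import Relation.Binary.PropositionalEquality

open Equivalence using (to; from)

+-cong-% : ∀ {n} .{{_ : NonZero n}} a a′ b b′ →
  a % n ≡ a′ % n → b % n ≡ b′ % n → (a + b) % n ≡ (a′ + b′) % n
+-cong-% {n} a a′ b b′ a≡a′ b≡b′ = begin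
  (a + b) % n            ≡⟨ %-distribˡ-+ a b n ⟩
  (a % n + b % n) % n    ≡⟨ cong₂ (λ x y → (x + y) % n) a≡a′ b≡b′ ⟩
  (a′ % n + b′ % n) % n  ≡⟨ %-distribˡ-+ a′ b′ n ⟨
  (a′ + b′) % n          ∎
  where open ≡-Reasoning

m+[n∸m%n]≡[1+m/n]*n : ∀ m n .{{_ : NonZero n}} → m + (n ∸ m % n) ≡ suc (m / n) * n
m+[n∸m%n]≡[1+m/n]*n m n = begin
  m + (n ∸ m % n)                    ≡⟨ cong (_+ (n ∸ m % n)) (m≡m%n+[m/n]*n m n) ⟩
  (m % n + m / n * n) + (n ∸ m % n)  ≡⟨ xy∙z≈y∙xz (m % n) (m / n * n) (n ∸ m % n) ⟩
  m / n * n + (m % n + (n ∸ m % n))  ≡⟨ cong (m / n * n +_) (m+[n∸m]≡n (m%n≤n m n)) ⟩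
  m / n * n + n                      ≡⟨ +-comm (m / n * n) n ⟩
  suc (m / n) * n                    ∎
  where open ≡-Reasoning

[m+[k+[n∸k%n]]]%n≡m%n : ∀ m k n .{{_ : NonZero n}} → (m + (k + (n ∸ k % n))) % n ≡ m % n
[m+[k+[n∸k%n]]]%n≡m%n m k n =
  trans (cong (λ t → (m + t) % n) (m+[n∸m%n]≡[1+m/n]*n k n)) ([m+kn]%n≡m%n m (suc (k / n)) n)

%-cancelʳ-+ : ∀ {n} .{{_ : NonZero n}} a b c → (a + c) % n ≡ (b + c) % n → a % n ≡ b % n
%-cancelʳ-+ {n} a b c eq = begin
  a % n                        ≡⟨ [m+[k+[n∸k%n]]]%n≡m%n a c n ⟨
  (a + (c + (n ∸ c % n))) % n  ≡⟨ cong (_% n) (+-assoc a c _) ⟨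
  (a + c + (n ∸ c % n)) % n    ≡⟨ +-cong-% (a + c) (b + c) _ _ eq refl ⟩
  (b + c + (n ∸ c % n)) % n    ≡⟨ cong (_% n) (+-assoc b c _) ⟩
  (b + (c + (n ∸ c % n))) % n  ≡⟨ [m+[k+[n∸k%n]]]%n≡m%n b c n ⟩
  b % n                        ∎
  where open ≡-Reasoning

%-cancelˡ-+ : ∀ {n} .{{_ : NonZero n}} c a b → (c + a) % n ≡ (c + b) % n → a % n ≡ b % n
%-cancelˡ-+ {n} c a b eq =
  %-cancelʳ-+ a b c (trans (cong (_% n) (+-comm a c)) (trans eq (cong (_% n) (+-comm c b))))

%-injective-< : ∀ {n} .{{_ : NonZero n}} {a b} → a < n → b < n → a % n ≡ b % n → a ≡ b
%-injective-< a<n b<n eq = trans (sym (m<n⇒m%n≡m a<n)) (trans eq (m<n⇒m%n≡m b<n))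

%-injective-above : ∀ {n} .{{_ : NonZero n}} {a b} → a ≤ b → b < a + n → a % n ≡ b % n → a ≡ b
%-injective-above {n} {a} {b} a≤b b<a+n eq = begin
  0 + a          ≡⟨ cong (_+ a) (%-injective-< d<n (>-nonZero⁻¹ n) d%n≡0%n) ⟨
  (b ∸ a) + a    ≡⟨ m∸n+n≡m a≤b ⟩
  b              ∎
  where
  open ≡-Reasoning
  d<n : b ∸ a < n
  d<n = +-cancelʳ-< a (b ∸ a) n (subst₂ _<_ (sym (m∸n+n≡m a≤b)) (+-comm a n) b<a+n)
  d%n≡0%n : (b ∸ a) % n ≡ 0 % n
  d%n≡0%n = %-cancelʳ-+ (b ∸ a) 0 a (trans (cong (_% n) (m∸n+n≡m a≤b)) (sym eq))

%-injective-near : ∀ {n} .{{_ : NonZero n}} {a b} → a < b + n → b < a + n → a % n ≡ b % n → a ≡ b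
%-injective-near {a = a} {b} a<b+n b<a+n eq with ≤-total a b
... | inj₁ a≤b = %-injective-above a≤b b<a+n eq
... | inj₂ b≤a = sym (%-injective-above b≤a a<b+n (sym eq))

%-cong-%2 : ∀ {n} .{{_ : NonZero n}} a b → 2 ∣ n → a % n ≡ b % n → a % 2 ≡ b % 2
%-cong-%2 {n} a b 2∣n eq = begin
  a % 2      ≡⟨ m∣n⇒o%n%m≡o%m 2 n a 2∣n ⟨
  a % n % 2  ≡⟨ cong (_% 2) eq ⟩
  b % n % 2  ≡⟨ m∣n⇒o%n%m≡o%m 2 n b 2∣n ⟩
  b % 2      ∎
  where open ≡-Reasoning

even⊎odd : ∀ a → Even a ⊎ Odd a
even⊎odd zero = inj₁ refl
even⊎odd (suc zero) = inj₂ refl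
even⊎odd (suc (suc a)) = even⊎odd a

odd-sum⇒opposite-parity : ∀ {a b} → Odd (a + b) → (Odd a × Even b) ⊎ (Even a × Odd b)
odd-sum⇒opposite-parity {a} {b} a+b-odd with even⊎odd a | even⊎odd b
... | inj₂ a-odd  | inj₁ b-even = inj₁ (a-odd , b-even)
... | inj₁ a-even | inj₂ b-odd  = inj₂ (a-even , b-odd)
... | inj₁ a-even | inj₁ b-even with () ← trans (sym a+b-odd) (+-cong-% {2} a 0 b 0 a-even b-even)
... | inj₂ a-odd  | inj₂ b-odd  with () ← trans (sym a+b-odd) (+-cong-% {2} a 1 b 1 a-odd b-odd)

odd-summand : ∀ {a b} → Odd a → Even (a + b) → Odd b
odd-summand {a} {b} a-odd a+b-even with even⊎odd b
... | inj₂ b-odd = b-odd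
... | inj₁ b-even with () ← trans (sym a+b-even) (+-cong-% {2} a 1 b 0 a-odd b-even)

odd-jump⇒odd-sum : ∀ {a b s} → Odd s → b % 2 ≡ (a + s) % 2 → Odd (a + b)
odd-jump⇒odd-sum {a} {b} {s} s-odd b≡a+s = begin
  (a + b) % 2        ≡⟨ +-cong-% a a b (a + s) refl b≡a+s ⟩
  (a + (a + s)) % 2  ≡⟨ cong (_% 2) (a+[a+s]≡s+a*2 a s) ⟩
  (s + a * 2) % 2    ≡⟨ [m+kn]%n≡m%n s a 2 ⟩
  s % 2              ≡⟨ s-odd ⟩
  1                  ∎
  where
  open ≡-Reasoning
  a+[a+s]≡s+a*2 : ∀ a s → a + (a + s) ≡ s + a * 2
  a+[a+s]≡s+a*2 = solve-∀

sum-between : ∀ {n} .{{_ : NonZero n}} {x y z w} → y < n → w < n →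
  (x + y) % n ≡ (z + w) % n → x < z → z < y → x < w × w < y
sum-between {n} {x} {y} {z} {w} y<n w<n eq x<z z<y =
  +-cancelʳ-< y x w (subst₂ _<_ (sym x+y≡z+w) (+-comm y w) (+-monoˡ-< w z<y)) ,
  +-cancelˡ-< z w y (subst (_< z + y) x+y≡z+w (+-monoˡ-< y x<z))
  where
  open ≤-Reasoning
  x+y<z+w+n : x + y < z + w + n
  x+y<z+w+n = begin-strict
    x + y      <⟨ +-mono-< x<z y<n ⟩
    z + n      ≤⟨ +-monoˡ-≤ n (m≤m+n z w) ⟩
    z + w + n  ∎
  z+w<x+y+n : z + w < x + y + n
  z+w<x+y+n = begin-strict
    z + w      <⟨ +-mono-< z<y w<n ⟩
    y + n      ≤⟨ +-monoˡ-≤ n (m≤n+m y x) ⟩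
    x + y + n  ∎
  x+y≡z+w : x + y ≡ z + w
  x+y≡z+w = %-injective-near x+y<z+w+n z+w<x+y+n eq

Between-same-sum : ∀ {n} .{{_ : NonZero n}} {x y z w} → x < n → y < n → w < n →
  (x + y) % n ≡ (z + w) % n → Between x y z → Between x y w
Between-same-sum x<n y<n w<n eq (inj₁ (x<z , z<y)) = inj₁ (sum-between y<n w<n eq x<z z<y)
Between-same-sum {n} {x} {y} x<n y<n w<n eq (inj₂ (y<z , z<x)) =
  inj₂ (sum-between x<n w<n (trans (cong (_% n) (+-comm y x)) eq) y<z z<x)

same-sum⇒¬interleaved : ∀ {n} .{{_ : NonZero n}} {x y z w} → x < n → y < n → z < n → w < n →
  (x + y) % n ≡ (z + w) % n →
  ¬ ((Between x y z × ¬ Between x y w) ⊎ (¬ Between x y z × Between x y w))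
same-sum⇒¬interleaved x<n y<n z<n w<n eq (inj₁ (xyz , ¬xyw)) =
  ¬xyw (Between-same-sum x<n y<n w<n eq xyz)
same-sum⇒¬interleaved {n} {z = z} {w} x<n y<n z<n w<n eq (inj₂ (¬xyz , xyw)) =
  ¬xyz (Between-same-sum x<n y<n z<n (trans eq (cong (_% n) (+-comm z w))) xyw)

odd⇒n≡1+[n/2]*2 : ∀ {n} → Odd n → n ≡ suc (n / 2 * 2)
odd⇒n≡1+[n/2]*2 {n} n-odd = trans (m≡m%n+[m/n]*n n 2) (cong (_+ n / 2 * 2) n-odd)

⌊n/2⌋≤countᵇ-tabulate : ∀ {A : Set} (p : A → Bool) n (f : Fin n → A) →
  (∀ i → Odd (toℕ i) → T (p (f i))) → ⌊ n /2⌋ ≤ countᵇ p (tabulate f)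
⌊n/2⌋≤countᵇ-tabulate p zero f odd⇒p = z≤n
⌊n/2⌋≤countᵇ-tabulate p (suc zero) f odd⇒p = z≤n
⌊n/2⌋≤countᵇ-tabulate p (suc (suc n)) f odd⇒p
  with p (f Fin.zero) | p (f (Fin.suc Fin.zero)) | odd⇒p (Fin.suc Fin.zero) refl
     | ⌊n/2⌋≤countᵇ-tabulate p n (f ∘ Fin.suc ∘ Fin.suc) (odd⇒p ∘ Fin.suc ∘ Fin.suc)
... | true  | true | _ | rest = s≤s (m≤n⇒m≤1+n rest)
... | false | true | _ | rest = s≤s rest

odd≤⇒≤μ : ∀ {s k} → Odd s → s ≤ k → s ≤ μ k
odd≤⇒≤μ {s} {k} s-odd s≤k with even⊎odd k
... | inj₂ k-odd rewrite k-odd = s≤k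
... | inj₁ k-even rewrite k-even =
  subst (s ≤_) (pred[m∸n]≡m∸[1+n] k 0) (<⇒≤pred (≤∧≢⇒< s≤k s≢k))
  where
  s≢k : s ≢ k
  s≢k refl with () ← trans (sym s-odd) k-even

odd⇒isJumpᵇ : ∀ {s k} → Odd s → s ≤ k → T (isJumpᵇ k s)
odd⇒isJumpᵇ {zero} ()
odd⇒isJumpᵇ {suc s} {k} s-odd s≤k =
  from T-∧ (≡⇒≡ᵇ (suc s % 2) 1 s-odd ,
            from T-∧ (≤⇒≤ᵇ (s≤s (z≤n {s})) , ≤⇒≤ᵇ (odd≤⇒≤μ s-odd s≤k)))

Jump : (k : ℕ) → Fin (2 * k) → Fin (2 * k) → ℕ → Set
Jump k i j s = (label j ≡ (label i + s) [mod (2 * k) ]) ⊎ (label i ≡ (label j + s) [mod (2 * k) ])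

jumpEdgeᵇ : (k : ℕ) → Fin (2 * k) → Fin (2 * k) → ℕ → Bool
jumpEdgeᵇ k i j s = isJumpᵇ k s ∧ (edgeᵇ (2 * k) i j s ∨ edgeᵇ (2 * k) j i s)

Adj-intro : ∀ {k} i j s → Odd s → s ≤ k → Jump k i j s → Adj k i j
Adj-intro {k} i j s s-odd s≤k jump = any⁺ (jumpEdgeᵇ k i j) (lose (∈-upTo⁺ (s≤s s≤k))
  (from T-∧ (odd⇒isJumpᵇ s-odd s≤k , from T-∨ (Sum.map (≡⇒≡ᵇ _ _) (≡⇒≡ᵇ _ _) jump))))

Adj-elim : ∀ k i j → Adj k i j → Σ ℕ λ s → Odd s × Jump k i j s
Adj-elim k i j adj with satisfied (any⁻ (jumpEdgeᵇ k i j) (upTo (suc k)) adj)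
... | s , jump-edge with to T-∧ jump-edge
... | isJump , edge =
  s , ≡ᵇ⇒≡ _ 1 (proj₁ (to T-∧ isJump)) , Sum.map (≡ᵇ⇒≡ _ _) (≡ᵇ⇒≡ _ _) (to T-∨ edge)

first-vertex-adjacent-to-even : ∀ k (j : Fin (2 * suc k)) → Odd (toℕ j) → Adj (suc k) Fin.zero j
first-vertex-adjacent-to-even k j j-odd with toℕ j ≤? suc k
... | yes j≤k = Adj-intro Fin.zero j (toℕ j) j-odd j≤k (inj₁ refl)
... | no  j≰k = Adj-intro Fin.zero j s s-odd s≤k (inj₂ wraps)
  where
  N = 2 * suc k
  s = N ∸ toℕ j
  j+s≡N : toℕ j + s ≡ N
  j+s≡N = m+[n∸m]≡n (<⇒≤ (toℕ<n j))
  s-odd : Odd s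
  s-odd = odd-summand {toℕ j} j-odd (subst Even (sym j+s≡N) (n∣m⇒m%n≡0 N 2 (m∣m*n (suc k))))
  s≤k : s ≤ suc k
  s≤k = begin
    N ∸ toℕ j              ≤⟨ ∸-monoʳ-≤ N (<⇒≤ (≰⇒> j≰k)) ⟩
    N ∸ suc k              ≡⟨ m+n∸m≡n (suc k) (suc k + 0) ⟩
    suc k + 0              ≡⟨ +-identityʳ (suc k) ⟩
    suc k                  ∎
    where open ≤-Reasoning
  wraps : 1 % N ≡ (suc (toℕ j) + s) % N
  wraps = sym (trans (cong (λ t → suc t % N) j+s≡N) ([m+n]%n≡m%n 1 N))

k≤Δ : ∀ k → k ≤ Δ k
k≤Δ zero = z≤n
k≤Δ (suc k) = begin
  suc k                    ≡⟨ n≡⌊n+n/2⌋ (suc k) ⟩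
  ⌊ suc k + suc k /2⌋      ≡⟨ cong (λ t → ⌊ suc k + t /2⌋) (+-identityʳ (suc k)) ⟨
  ⌊ 2 * suc k /2⌋          ≤⟨ ⌊n/2⌋≤countᵇ-tabulate (adjᵇ (suc k) Fin.zero) (2 * suc k) (λ j → j)
                                (first-vertex-adjacent-to-even k) ⟩
  degree (suc k) Fin.zero  ≤⟨ m≤m⊔n _ _ ⟩
  Δ (suc k)                ∎
  where open ≤-Reasoning

-- Taking k = suc k′ makes the modulus 2 * k reduce to a successor, so that
-- a ≡ b [mod 2 * k ] is definitionally a % (2 * k) ≡ b % (2 * k).
module Colouring (k′ : ℕ) (pos : Fin (2 * suc k′) → Fin (2 * suc k′)) (ysl : IsYSL (suc k′) pos) where

  k N : ℕ
  k = suc k′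
  N = 2 * k

  2∣N : 2 ∣ N
  2∣N = m∣m*n k

  m : ℕ
  m = proj₁ ysl

  pos-odd : ∀ v → Odd (label v) → label (pos v) ≡ label v
  pos-odd v = proj₁ (proj₂ ysl v)

  pos-even : ∀ v → Even (label v) → Even (label (pos v))
  pos-even v = proj₁ ∘ proj₂ (proj₂ ysl v)

  pos-even-sum : ∀ v → Even (label v) → (label v + label (pos v)) % N ≡ (2 * m) % N
  pos-even-sum v = proj₂ ∘ proj₂ (proj₂ ysl v)

  pos-parity : ∀ v → label (pos v) % 2 ≡ label v % 2
  pos-parity v with even⊎odd (label v)
  ... | inj₁ v-even = trans (pos-even v v-even) (sym v-even)
  ... | inj₂ v-odd  = cong (_% 2) (pos-odd v v-odd)

  same-pos⇒same-parity : ∀ {v w} → pos v ≡ pos w → label v % 2 ≡ label w % 2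
  same-pos⇒same-parity {v} {w} pv≡pw =
    trans (sym (pos-parity v)) (trans (cong (λ u → label u % 2) pv≡pw) (pos-parity w))

  pos-injective : Injective _≡_ _≡_ pos
  pos-injective {v} {w} pv≡pw with even⊎odd (label v)
  ... | inj₂ v-odd = toℕ-injective (suc-injective (begin
    label v        ≡⟨ pos-odd v v-odd ⟨
    label (pos v)  ≡⟨ cong label pv≡pw ⟩
    label (pos w)  ≡⟨ pos-odd w (trans (sym (same-pos⇒same-parity pv≡pw)) v-odd) ⟩
    label w        ∎))
    where open ≡-Reasoning
  ... | inj₁ v-even = toℕ-injective (%-injective-< (toℕ<n v) (toℕ<n w)
    (%-cancelˡ-+ {N} 1 (toℕ v) (toℕ w) (%-cancelʳ-+ {N} (label v) (label w) (label (pos v)) sums)))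
    where
    open ≡-Reasoning
    sums : (label v + label (pos v)) % N ≡ (label w + label (pos v)) % N
    sums = begin
      (label v + label (pos v)) % N  ≡⟨ pos-even-sum v v-even ⟩
      (2 * m) % N                    ≡⟨ pos-even-sum w (trans (sym (same-pos⇒same-parity pv≡pw)) v-even) ⟨
      (label w + label (pos w)) % N  ≡⟨ cong (λ u → (label w + label u) % N) pv≡pw ⟨
      (label w + label (pos v)) % N  ∎

  P : Fin N → ℕ
  P v = toℕ (pos v)

  positionSum : Fin N → Fin N → ℕ
  positionSum i j = (P i + P j) % N

  positionSum-comm : ∀ i j → positionSum i j ≡ positionSum j i
  positionSum-comm i j = cong (_% N) (+-comm (P i) (P j))

  odd-label-sum : ∀ i j → Adj k i j → Odd (label i + label j)
  odd-label-sum i j adj with Adj-elim k i j adj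
  ... | s , s-odd , inj₁ j≡i+s =
    odd-jump⇒odd-sum {label i} s-odd (%-cong-%2 (label j) (label i + s) 2∣N j≡i+s)
  ... | s , s-odd , inj₂ i≡j+s = subst Odd (+-comm (label j) (label i))
    (odd-jump⇒odd-sum {label j} s-odd (%-cong-%2 (label i) (label j + s) 2∣N i≡j+s))

  odd-positionSum : ∀ i j → Adj k i j → Odd (positionSum i j)
  odd-positionSum i j adj = begin
    (P i + P j) % N % 2                 ≡⟨ m∣n⇒o%n%m≡o%m 2 N (P i + P j) 2∣N ⟩
    suc (suc (P i + P j)) % 2           ≡⟨ cong (λ t → suc t % 2) (+-suc (P i) (P j)) ⟨
    (label (pos i) + label (pos j)) % 2 ≡⟨ +-cong-% {2} (label (pos i)) (label i) (label (pos j)) (label j)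
                                             (pos-parity i) (pos-parity j) ⟩
    (label i + label j) % 2             ≡⟨ odd-label-sum i j adj ⟩
    1                                   ∎
    where open ≡-Reasoning

  positionSum/2<k : ∀ i j → positionSum i j / 2 < k
  positionSum/2<k i j = m<n*o⇒m/o<n (subst (positionSum i j <_) (*-comm 2 k) (m%n<n (P i + P j) N))

  colour : Fin N → Fin N → Fin (Δ k)
  colour i j = inject≤ (fromℕ< (positionSum/2<k i j)) (k≤Δ k)

  toℕ-colour : ∀ i j → toℕ (colour i j) ≡ positionSum i j / 2
  toℕ-colour i j = trans (toℕ-inject≤ _ (k≤Δ k)) (toℕ-fromℕ< (positionSum/2<k i j))

  positionSum≡1+colour*2 : ∀ i j → Adj k i j → positionSum i j ≡ suc (toℕ (colour i j) * 2)
  positionSum≡1+colour*2 i j adj =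
    trans (odd⇒n≡1+[n/2]*2 (odd-positionSum i j adj)) (cong (λ c → suc (c * 2)) (sym (toℕ-colour i j)))

  colour-sym : ∀ i j → colour i j ≡ colour j i
  colour-sym i j = toℕ-injective (begin
    toℕ (colour i j)      ≡⟨ toℕ-colour i j ⟩
    positionSum i j / 2   ≡⟨ cong (_/ 2) (positionSum-comm i j) ⟩
    positionSum j i / 2   ≡⟨ toℕ-colour j i ⟨
    toℕ (colour j i)      ∎)
    where open ≡-Reasoning

  colour-injective : ∀ i j u v → Adj k i j → Adj k u v → colour i j ≡ colour u v →
    positionSum i j ≡ positionSum u v
  colour-injective i j u v ij uv same = begin
    positionSum i j              ≡⟨ positionSum≡1+colour*2 i j ij ⟩
    suc (toℕ (colour i j) * 2)   ≡⟨ cong (λ c → suc (toℕ c * 2)) same ⟩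
    suc (toℕ (colour u v) * 2)   ≡⟨ positionSum≡1+colour*2 u v uv ⟨
    positionSum u v              ∎
    where open ≡-Reasoning

  colour-proper : ∀ u v w → Adj k u v → Adj k u w → v ≢ w → colour u v ≢ colour u w
  colour-proper u v w uv uw v≢w same = v≢w (pos-injective (toℕ-injective
    (%-injective-< (toℕ<n (pos v)) (toℕ<n (pos w))
      (%-cancelˡ-+ {N} (P u) (P v) (P w) (colour-injective u v u w uv uw same)))))

  colour-noncrossing : ∀ a b c d → Adj k a b → Adj k c d → Cross pos a b c d →
    colour a b ≢ colour c d
  colour-noncrossing a b c d ab cd (_ , interleave) same =
    same-sum⇒¬interleaved (toℕ<n (pos a)) (toℕ<n (pos b)) (toℕ<n (pos c)) (toℕ<n (pos d))
      (colour-injective a b c d ab cd same) interleave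

  -- a representative of r + 2 − 2m modulo N
  jump : ℕ → ℕ
  jump r = 2 + r + (N ∸ (2 * m) % N)

  odd-even-jump : ∀ o e → Odd (label o) → Even (label e) →
    label o % N ≡ (label e + jump (positionSum o e)) % N
  odd-even-jump o e o-odd e-even =
    %-cancelʳ-+ {N} (label o) (label e + jump r) (label (pos e)) sums
    where
    open ≡-Reasoning
    r = positionSum o e
    sums : (label o + label (pos e)) % N ≡ (label e + jump r + label (pos e)) % N
    sums = begin
      (label o + label (pos e)) % N              ≡⟨ cong (λ x → (x + label (pos e)) % N) (pos-odd o o-odd) ⟨
      (label (pos o) + label (pos e)) % N        ≡⟨ cong (λ t → suc t % N) (+-suc (P o) (P e)) ⟩
      (2 + (P o + P e)) % N                      ≡⟨ +-cong-% {N} 2 2 (P o + P e) r refl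
                                                      (sym (m%n%n≡m%n (P o + P e) N)) ⟩
      (2 + r) % N                                ≡⟨ [m+[k+[n∸k%n]]]%n≡m%n (2 + r) (2 * m) N ⟨
      (2 + r + (2 * m + (N ∸ (2 * m) % N))) % N  ≡⟨ cong (_% N) (x∙yz≈y∙xz (2 + r) (2 * m) _) ⟩
      (2 * m + jump r) % N                       ≡⟨ +-cong-% {N} (label e + label (pos e)) (2 * m)
                                                      (jump r) (jump r) (pos-even-sum e e-even) refl ⟨
      (label e + label (pos e) + jump r) % N     ≡⟨ cong (_% N) (xy∙z≈xz∙y (label e) (label (pos e)) _) ⟩
      (label e + jump r + label (pos e)) % N     ∎

  edge-jump : ∀ i j → Adj k i j → Jump k i j (jump (positionSum i j))
  edge-jump i j adj with odd-sum⇒opposite-parity {label i} (odd-label-sum i j adj)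
  ... | inj₁ (i-odd , j-even) = inj₂ (odd-even-jump i j i-odd j-even)
  ... | inj₂ (i-even , j-odd) = inj₁ (subst (λ r → label j % N ≡ (label i + jump r) % N)
    (positionSum-comm j i) (odd-even-jump j i j-odd i-even))

  colour-class-jump : ∀ γ → Σ ℕ λ s → ∀ i j → Adj k i j → colour i j ≡ γ → Jump k i j s
  colour-class-jump γ = jump (suc (toℕ γ * 2)) , λ i j adj colour≡γ →
    subst (Jump k i j ∘ jump)
      (trans (positionSum≡1+colour*2 i j adj) (cong (λ c → suc (toℕ c * 2)) colour≡γ))
      (edge-jump i j adj)

theorem2 : (k : ℕ) → 2 ≤ k →
    (pos : Fin (2 * k) → Fin (2 * k)) → IsYSL k pos →
    Σ (Fin (2 * k) → Fin (2 * k) → Fin (Δ k)) λ col →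
      -- colour of an edge does not depend on the orientation of its endpoints
      (∀ i j → Adj k i j → col i j ≡ col j i) ×
      -- (i) same-coloured edges share no endpoint ...
      (∀ u v w → Adj k u v → Adj k u w → v ≢ w → col u v ≢ col u w) ×
      -- ... and do not cross
      (∀ a b c d → Adj k a b → Adj k c d → Cross pos a b c d → col a b ≢ col c d) ×
      -- (ii) each colour class uses a single jump-length s
      (∀ (γ : Fin (Δ k)) → Σ ℕ λ s → ∀ i j → Adj k i j → col i j ≡ γ →
        (label j ≡ (label i + s) [mod (2 * k) ]) ⊎ (label i ≡ (label j + s) [mod (2 * k) ]))
theorem2 zero ()
theorem2 (suc k′) _ pos ysl =
  colour , (λ i j _ → colour-sym i j) , colour-proper , colour-noncrossing , colour-class-jump
  where open Colouring k′ pos ysl
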